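{- Let $c\geq1$ be an integer and let $Y\subseteq\{0,1\}^{\mathbb{Z}}$ be a $c$-block gluing subshift whose language contains both letters $0$ and $1$, and such that none of the words $11,101,1001,\dots,10^{c-1}1$ belongs to $L_Y$. Then $$Y=SFT\{11,101,1001,\dots,10^{c-1}1\}.$$
   Context: A subshift is a closed shift-invariant subset of $\{0,1\}^{\mathbb{Z}}$; $L_Y$ is its language (finite words occurring in elements of $Y$). $Y$ is $c$-block gluing if for all $u,v\in L_Y$ and every integer $m\geq c$ there is a word $w$ with $|w|=m$ and $uwv\in L_Y$. $10^j1$ denotes $1$ followed by $j$ zeros followed by $1$. For a finite set $S$ of words, $SFT(S)$ is the set of configurations in which no word of $S$ occurs. -}

module Defs where

open import Data.Bool using (Bool; true; false)
open import Data.Nat using (ℕ; _<_; _≥_; _≤_)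
open import Data.Integer as ℤ using (ℤ; +_; -_)
open import Data.List using (List; []; _∷_; _++_; length; replicate)
open import Data.Fin using (Fin; toℕ)
open import Data.List.Base using (lookup)
open import Data.Product using (Σ; ∃; _×_; _,_)
open import Relation.Binary.PropositionalEquality using (_≡_)
open import Relation.Nullary using (¬_)
open import Function.Bundles using (_⇔_)

-- Alphabet {0,1} encoded as Bool: false = 0, true = 1.
Config : Set
Config = ℤ → Bool

ConfigSet : Set₁
ConfigSet = Config → Set

shift : Config → Config
shift x i = x (i ℤ.+ + 1)

OccursAt : List Bool → Config → ℤ → Set
OccursAt w x i = (k : Fin (length w)) → x (i ℤ.+ + toℕ k) ≡ lookup w k

Occurs : List Bool → Config → Set
Occurs w x = ∃ λ i → OccursAt w x i

ShiftInvariant : ConfigSet → Set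
ShiftInvariant Y = ∀ x → (Y x → Y (shift x)) × (Y (shift x) → Y x)

-- Closed in the product topology: if every central window x_{[-n,n]} is
-- matched by some point of Y, then x ∈ Y.
AgreeOn : ℕ → Config → Config → Set
AgreeOn n x y = ∀ (i : ℤ) → - (+ n) ℤ.≤ i → i ℤ.≤ + n → x i ≡ y i

Closed : ConfigSet → Set
Closed Y = ∀ x → (∀ n → ∃ λ y → Y y × AgreeOn n x y) → Y x

record Subshift (Y : ConfigSet) : Set where
  field
    shiftInv : ShiftInvariant Y
    closed   : Closed Y

L : ConfigSet → List Bool → Set
L Y w = ∃ λ y → Y y × Occurs w y

BlockGluing : ℕ → ConfigSet → Set
BlockGluing c Y = ∀ u v → L Y u → L Y v → ∀ m → m ≥ c →
  ∃ λ (w : List Bool) → length w ≡ m × L Y (u ++ w ++ v)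

one0one : ℕ → List Bool
one0one j = true ∷ replicate j false ++ true ∷ []

SFTgap : ℕ → ConfigSet
SFTgap c x = ∀ j → j < c → ¬ Occurs (one0one j) x

{-# OPTIONS --safe #-}
-- A point of Y never has two 1s within distance c, since that would exhibit a word 1 0ʲ 1
-- with j < c. Conversely, let x have no two 1s within distance c. As Y is closed and shift
-- invariant, it suffices that every word u of x lies in L_Y, and by induction on |u| we show
-- that u 0ᴹ ∈ L_Y for every M. Gluing gives 0ᴹ and 1 0ᴹ, and gluing v ∈ L_Y to 1 0ᴹ across
-- a gap of length c gives v 0ᶜ 1 0ᴹ: a 1 inside the gap would lie within distance c of the
-- next 1. Appending a 0 to u consumes one of the trailing zeros; appending a 1 is the case
-- v 0ᶜ 1 with v the part of u before its last c letters, which are all 0 (or, if |u| < c,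
-- the case u 1 0ᴹ read off as a suffix of 0ᶜ 1 0ᴹ).
module Submission where

open import Defs
open import Data.Bool using (Bool; true; false)
open import Data.Bool.Properties using (¬-not)
open import Data.Nat using (ℕ; zero; suc; _+_; _∸_; _≤_; _<_; _≥_; z≤n; s≤s; z<s; s<s; _≤?_)
open import Data.Nat.Properties
open import Data.Integer as ℤ using (ℤ; +_; -[1+_])
import Data.Integer.Properties as ℤₚ
open import Data.List using (List; []; _∷_; _++_; length; replicate; applyUpTo)
open import Data.List.Base using (lookup)
open import Data.List.Properties using (length-++; length-applyUpTo; lookup-applyUpTo)
open import Data.Fin using (Fin; toℕ; fromℕ<)
open import Data.Fin.Properties using (toℕ-fromℕ<; toℕ<n)
open import Data.Product using (∃; _×_; _,_; proj₁; proj₂)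
open import Data.Sum using (inj₁; inj₂)
open import Data.Empty using (⊥)
open import Function using (_∘_)
open import Function.Bundles using (_⇔_; mk⇔)
open import Relation.Binary.PropositionalEquality
open import Relation.Nullary using (¬_; yes; no)

Word : Set
Word = ℕ → Bool

zeros : Word
zeros _ = false

pulse : Word
pulse zero    = true
pulse (suc _) = false

append : ℕ → Word → Word → Word
append zero    f g k       = g k
append (suc n) f g zero    = f zero
append (suc n) f g (suc k) = append n (f ∘ suc) g k

drop : ℕ → Word → Word
drop n f k = f (n + k)

Agree : ℕ → Word → Word → Set
Agree n f g = ∀ k → k < n → f k ≡ g k

Agree-cons : ∀ {n f g} → f 0 ≡ g 0 → Agree n (f ∘ suc) (g ∘ suc) → Agree (suc n) f g
Agree-cons f0≡g0 _    zero    _         = f0≡g0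
Agree-cons _     tail (suc k) (s<s k<n) = tail k k<n

Agree-snoc : ∀ {n f g} → Agree n f g → f n ≡ g n → Agree (suc n) f g
Agree-snoc {n} init fn≡gn k k<1+n with m<1+n⇒m<n∨m≡n k<1+n
... | inj₁ k<n  = init k k<n
... | inj₂ refl = fn≡gn

append-+ : ∀ n {f g} k → append n f g (n + k) ≡ g k
append-+ zero    k = refl
append-+ (suc n) k = append-+ n k

append-prefix : ∀ n {f g} → Agree n (append n f g) f
append-prefix zero    _       ()
append-prefix (suc n) zero    _         = refl
append-prefix (suc n) (suc k) (s<s k<n) = append-prefix n k k<n

append-take-drop : ∀ n (f : Word) → f ≗ append n f (drop n f)
append-take-drop zero    f k       = refl
append-take-drop (suc n) f zero    = refl
append-take-drop (suc n) f (suc k) = append-take-drop n (f ∘ suc) k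

append-assoc : ∀ m {n} f g h → append (m + n) (append m f g) h ≗ append m f (append n g h)
append-assoc zero    f g h k       = refl
append-assoc (suc m) f g h zero    = refl
append-assoc (suc m) f g h (suc k) = append-assoc m (f ∘ suc) g h k

drop-append : ∀ s {n} f g → drop s (append (s + n) f g) ≗ append n (drop s f) g
drop-append zero    f g k = refl
drop-append (suc s) f g k = drop-append s (f ∘ suc) g k

append-cong : ∀ {m n f₁ f₂ g₁ g₂} → Agree m f₁ f₂ → Agree n g₁ g₂ →
              Agree (m + n) (append m f₁ g₁) (append m f₂ g₂)
append-cong {zero}  _     g₁≈g₂ = g₁≈g₂
append-cong {suc m} f₁≈f₂ g₁≈g₂ =
  Agree-cons (f₁≈f₂ 0 z<s) (append-cong (λ k k<m → f₁≈f₂ (suc k) (s<s k<m)) g₁≈g₂)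

append-zeros : ∀ n → append n zeros zeros ≗ zeros
append-zeros zero    k       = refl
append-zeros (suc n) zero    = refl
append-zeros (suc n) (suc k) = append-zeros n k

append-zeros-extend : ∀ n {f} → f n ≡ false → append n f zeros ≗ append (suc n) f zeros
append-zeros-extend zero    fn zero    = sym fn
append-zeros-extend zero    fn (suc k) = refl
append-zeros-extend (suc n) fn zero    = refl
append-zeros-extend (suc n) fn (suc k) = append-zeros-extend n fn k

append-zeros-ending-in-one : ∀ n {f g} → f n ≡ true → Agree n f g →
                             append (suc n) f zeros ≗ append n g pulse
append-zeros-ending-in-one zero    fn _   zero    = fn
append-zeros-ending-in-one zero    fn _   (suc k) = refl
append-zeros-ending-in-one (suc n) fn f≈g zero    = f≈g 0 z<s
append-zeros-ending-in-one (suc n) fn f≈g (suc k) =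
  append-zeros-ending-in-one n fn (λ k k<n → f≈g (suc k) (s<s k<n)) k

first-true : ∀ (f : Word) n → f n ≡ true → ∃ λ t → t ≤ n × f t ≡ true × Agree t f zeros
first-true f zero    fn = 0 , z≤n , fn , λ _ ()
first-true f (suc n) fn with f 0 in f0
... | true  = 0 , z≤n , f0 , λ _ ()
... | false with first-true (f ∘ suc) n fn
...   | t , t≤n , ft , below = suc t , s≤s t≤n , ft , Agree-cons f0 below

toWord : List Bool → Word
toWord []      _       = false
toWord (b ∷ w) zero    = b
toWord (b ∷ w) (suc k) = toWord w k

toWord-lookup : ∀ w (k : Fin (length w)) → toWord w (toℕ k) ≡ lookup w k
toWord-lookup (b ∷ w) Fin.zero    = refl
toWord-lookup (b ∷ w) (Fin.suc k) = toWord-lookup w k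

toWord-++ : ∀ u {v} → toWord (u ++ v) ≗ append (length u) (toWord u) (toWord v)
toWord-++ []      k       = refl
toWord-++ (b ∷ u) zero    = refl
toWord-++ (b ∷ u) (suc k) = toWord-++ u k

toWord-applyUpTo-++ : ∀ f n {v} → toWord (applyUpTo f n ++ v) ≗ append n f (toWord v)
toWord-applyUpTo-++ f zero    k       = refl
toWord-applyUpTo-++ f (suc n) zero    = refl
toWord-applyUpTo-++ f (suc n) (suc k) = toWord-applyUpTo-++ (f ∘ suc) n k

toWord-applyUpTo : ∀ f n → Agree n (toWord (applyUpTo f n)) f
toWord-applyUpTo f zero    _ ()
toWord-applyUpTo f (suc n) = Agree-cons refl (toWord-applyUpTo (f ∘ suc) n)

toWord-one0one : ∀ j → toWord (one0one j) ≗ append (suc j) pulse pulse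
toWord-one0one j zero    = refl
toWord-one0one j (suc k) = zeros-then-one j k
  where
  zeros-then-one : ∀ j → toWord (replicate j false ++ true ∷ []) ≗ append j zeros pulse
  zeros-then-one zero    zero    = refl
  zeros-then-one zero    (suc k) = refl
  zeros-then-one (suc j) zero    = refl
  zeros-then-one (suc j) (suc k) = zeros-then-one j k

length-one0one : ∀ j → length (one0one j) ≡ suc (suc j)
length-one0one zero    = refl
length-one0one (suc j) = cong suc (length-one0one j)

_from_ : Config → ℤ → Word
(x from i) k = x (i ℤ.+ + k)

from-+ : ∀ x i m → x from (i ℤ.+ + m) ≗ drop m (x from i)
from-+ x i m k = cong x (trans (ℤₚ.+-assoc i (+ m) (+ k)) (cong (λ j → i ℤ.+ j) (sym (ℤₚ.pos-+ m k))))

occursAt⇒Agree : ∀ w x i → OccursAt w x i → Agree (length w) (x from i) (toWord w)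
occursAt⇒Agree w x i occ k k<|w| = begin
  x (i ℤ.+ + k)                         ≡⟨ cong (λ m → x (i ℤ.+ + m)) (toℕ-fromℕ< k<|w|) ⟨
  x (i ℤ.+ + toℕ (fromℕ< k<|w|))        ≡⟨ occ (fromℕ< k<|w|) ⟩
  lookup w (fromℕ< k<|w|)                ≡⟨ toWord-lookup w (fromℕ< k<|w|) ⟨
  toWord w (toℕ (fromℕ< k<|w|))          ≡⟨ cong (toWord w) (toℕ-fromℕ< k<|w|) ⟩
  toWord w k                             ∎
  where open ≡-Reasoning

Agree⇒occursAt : ∀ w x i → Agree (length w) (x from i) (toWord w) → OccursAt w x i
Agree⇒occursAt w x i agree k = trans (agree (toℕ k) (toℕ<n k)) (toWord-lookup w k)

one0one-occursAt : ∀ j x p → Agree (suc (suc j)) (x from p) (append (suc j) pulse pulse) →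
                   OccursAt (one0one j) x p
one0one-occursAt j x p agree = Agree⇒occursAt (one0one j) x p λ k k<len →
  trans (agree k (subst (k <_) (length-one0one j) k<len)) (sym (toWord-one0one j k))

Sparse : ℕ → ℕ → Word → Set
Sparse c n f = ∀ {k l} → k < l → l ≤ k + c → l < n → f k ≡ true → f l ≡ true → ⊥

Sparse-resp : ∀ {c n f g} → Agree n f g → Sparse c n f → Sparse c n g
Sparse-resp f≈g sparse {k} {l} k<l l≤k+c l<n gk gl =
  sparse k<l l≤k+c l<n (trans (f≈g k (<-trans k<l l<n)) gk) (trans (f≈g l l<n) gl)

Sparse-before : ∀ {c n f k l} → Sparse c n f → k < l → l ≤ k + c → l < n → f l ≡ true → f k ≡ false
Sparse-before sparse k<l l≤k+c l<n fl = ¬-not λ fk → sparse k<l l≤k+c l<n fk fl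

Sparse-after : ∀ {c n f k l} → Sparse c n f → k < l → l ≤ k + c → l < n → f k ≡ true → f l ≡ false
Sparse-after sparse k<l l≤k+c l<n fk = ¬-not λ fl → sparse k<l l≤k+c l<n fk fl

-- Between two 1s at distance at most c, the first 1 after the left one closes a word 1 0ᵗ 1.
SFTgap⇒sparse : ∀ {c} x → SFTgap c x → ∀ i n → Sparse c n (x from i)
SFTgap⇒sparse {c} x gap i n {k} {l} k<l l≤k+c _ xk xl with m≤n⇒∃[o]m+o≡n k<l
... | e , refl with first-true (drop (suc k) (x from i)) e xl
...   | t , t≤e , xt , below =
  gap t t<c (i ℤ.+ + k , one0one-occursAt t x (i ℤ.+ + k) λ m m<t+2 →
    trans (from-+ x i k m) (one0one-at-k m m<t+2))
  where
  t<c : t < c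
  t<c = ≤-<-trans t≤e (+-cancelˡ-< k e c l≤k+c)
  one0one-at-k : Agree (suc (suc t)) (drop k (x from i)) (append (suc t) pulse pulse)
  one0one-at-k = Agree-cons (trans (cong (x from i) (+-identityʳ k)) xk) λ m m≤t → begin
    (x from i) (k + suc m)                            ≡⟨ cong (x from i) (+-suc k m) ⟩
    drop (suc k) (x from i) m                         ≡⟨ append-prefix (suc t) m m≤t ⟨
    append (suc t) (drop (suc k) (x from i)) zeros m  ≡⟨ append-zeros-ending-in-one t xt below m ⟩
    append t zeros pulse m                            ∎
    where open ≡-Reasoning

Realized : ConfigSet → ℕ → Word → Set
Realized Y n f = ∃ λ y → Y y × ∃ λ i → Agree n (y from i) f

module _ {Y : ConfigSet} where

  Realized-resp : ∀ {n f g} → Agree n f g → Realized Y n f → Realized Y n g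
  Realized-resp f≈g (y , Yy , i , agree) = y , Yy , i , λ k k<n → trans (agree k k<n) (f≈g k k<n)

  Realized-≤ : ∀ {m n f} → m ≤ n → Realized Y n f → Realized Y m f
  Realized-≤ m≤n (y , Yy , i , agree) = y , Yy , i , λ k k<m → agree k (<-≤-trans k<m m≤n)

  Realized-drop : ∀ s {n f} → Realized Y (s + n) f → Realized Y n (drop s f)
  Realized-drop s (y , Yy , i , agree) =
    y , Yy , i ℤ.+ + s , λ k k<n → trans (from-+ y i s k) (agree (s + k) (+-monoʳ-< s k<n))

  L⇒Realized : ∀ {w} → L Y w → Realized Y (length w) (toWord w)
  L⇒Realized {w} (y , Yy , i , occ) = y , Yy , i , occursAt⇒Agree w y i occ

  Realized⇒L : ∀ {n f} → Realized Y n f → L Y (applyUpTo f n)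
  Realized⇒L {n} {f} (y , Yy , i , agree) = y , Yy , i , λ k →
    trans (agree (toℕ k) (subst (toℕ k <_) (length-applyUpTo f n) (toℕ<n k)))
          (sym (lookup-applyUpTo f n k))

translate : ℤ → Config → Config
translate e x z = x (z ℤ.+ e)

translate-suc : ∀ k x → translate (+ suc k) x ≗ shift (translate (+ k) x)
translate-suc k x z =
  cong x (trans (cong (λ j → z ℤ.+ j) (ℤₚ.pos-+ 1 k)) (sym (ℤₚ.+-assoc z (+ 1) (+ k))))

+-minus-cancel : ∀ a z → a ℤ.+ (z ℤ.- a) ≡ z
+-minus-cancel a z = begin
  a ℤ.+ (z ℤ.- a)      ≡⟨ cong (λ j → a ℤ.+ j) (ℤₚ.+-comm z (ℤ.- a)) ⟩
  a ℤ.+ (ℤ.- a ℤ.+ z)  ≡⟨ ℤₚ.+-assoc a (ℤ.- a) z ⟨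
  (a ℤ.- a) ℤ.+ z      ≡⟨ cong (ℤ._+ z) (ℤₚ.+-inverseʳ a) ⟩
  + 0 ℤ.+ z            ≡⟨ ℤₚ.+-identityˡ z ⟩
  z                    ∎
  where open ≡-Reasoning

+-minus-swap : ∀ i z a → i ℤ.+ (z ℤ.- a) ≡ z ℤ.+ (i ℤ.- a)
+-minus-swap i z a = begin
  i ℤ.+ (z ℤ.- a)      ≡⟨ ℤₚ.+-assoc i z (ℤ.- a) ⟨
  (i ℤ.+ z) ℤ.- a      ≡⟨ cong (ℤ._- a) (ℤₚ.+-comm i z) ⟩
  (z ℤ.+ i) ℤ.- a      ≡⟨ ℤₚ.+-assoc z i (ℤ.- a) ⟩
  z ℤ.+ (i ℤ.- a)      ∎
  where open ≡-Reasoning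

centred-offset : ∀ n {z} → ℤ.- + n ℤ.≤ z → z ℤ.≤ + n →
                 ∃ λ k → + k ≡ z ℤ.- ℤ.- + n × k ≤ n + n
centred-offset n {z} -n≤z z≤+n = ℤ.∣ z ℤ.- ℤ.- + n ∣ , +∣k∣≡k , ℤₚ.drop‿+≤+ (begin
    + ℤ.∣ z ℤ.- ℤ.- + n ∣   ≡⟨ +∣k∣≡k ⟩
    z ℤ.- ℤ.- + n           ≡⟨ cong (λ j → z ℤ.+ j) (ℤₚ.neg-involutive (+ n)) ⟩
    z ℤ.+ + n               ≤⟨ ℤₚ.+-monoˡ-≤ (+ n) z≤+n ⟩
    + n ℤ.+ + n             ≡⟨ ℤₚ.pos-+ n n ⟨
    + (n + n)               ∎)
  where
  +∣k∣≡k : + ℤ.∣ z ℤ.- ℤ.- + n ∣ ≡ z ℤ.- ℤ.- + n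
  +∣k∣≡k = ℤₚ.0≤i⇒+∣i∣≡i (ℤₚ.i≤j⇒0≤j-i -n≤z)
  open ℤₚ.≤-Reasoning

module _ {Y : ConfigSet} (Y-subshift : Subshift Y) where
  open Subshift Y-subshift

  Y-resp-≗ : ∀ {x y} → Y x → x ≗ y → Y y
  Y-resp-≗ {x} {y} Yx x≗y = closed y λ _ → x , Yx , λ i _ _ → sym (x≗y i)

  translate-ℕ : ∀ k {x} → Y x → Y (translate (+ k) x)
  translate-ℕ zero    {x} Yx = Y-resp-≗ Yx λ z → cong x (sym (ℤₚ.+-identityʳ z))
  translate-ℕ (suc k) {x} Yx =
    Y-resp-≗ (proj₁ (shiftInv _) (translate-ℕ k Yx)) λ z → sym (translate-suc k x z)

  untranslate-ℕ : ∀ k {x} → Y (translate (+ k) x) → Y x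
  untranslate-ℕ zero    {x} Yx+k = Y-resp-≗ Yx+k λ z → cong x (ℤₚ.+-identityʳ z)
  untranslate-ℕ (suc k) {x} Yx+k =
    untranslate-ℕ k (proj₂ (shiftInv _) (Y-resp-≗ Yx+k (translate-suc k x)))

  translate-closed : ∀ e {x} → Y x → Y (translate e x)
  translate-closed (+ k)    = translate-ℕ k
  translate-closed -[1+ k ] {x} Yx = untranslate-ℕ (suc k) (Y-resp-≗ Yx λ z → cong x (sym (begin
    (z ℤ.+ + suc k) ℤ.+ -[1+ k ]  ≡⟨ ℤₚ.+-assoc z (+ suc k) -[1+ k ] ⟩
    z ℤ.+ (+ suc k ℤ.- + suc k)   ≡⟨ cong (λ j → z ℤ.+ j) (ℤₚ.+-inverseʳ (+ suc k)) ⟩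
    z ℤ.+ + 0                     ≡⟨ ℤₚ.+-identityʳ z ⟩
    z                             ∎)))
    where open ≡-Reasoning

  language-closed : ∀ {x} → (∀ a n → Realized Y n (x from a)) → Y x
  language-closed {x} realized = closed x window
    where
    window : ∀ n → ∃ λ y → Y y × AgreeOn n x y
    window n with realized (ℤ.- + n) (suc (n + n))
    ... | y , Yy , i , agree =
      translate (i ℤ.- a) y , translate-closed (i ℤ.- a) Yy , λ z -n≤z z≤+n →
        let k , +k≡z-a , k≤2n = centred-offset n -n≤z z≤+n in begin
          x z                        ≡⟨ cong x (+-minus-cancel a z) ⟨
          x (a ℤ.+ (z ℤ.- a))        ≡⟨ cong (λ j → x (a ℤ.+ j)) +k≡z-a ⟨
          x (a ℤ.+ + k)              ≡⟨ agree k (s≤s k≤2n) ⟨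
          y (i ℤ.+ + k)              ≡⟨ cong (λ j → y (i ℤ.+ j)) +k≡z-a ⟩
          y (i ℤ.+ (z ℤ.- a))        ≡⟨ cong y (+-minus-swap i z a) ⟩
          y (z ℤ.+ (i ℤ.- a))        ∎
      where
      open ≡-Reasoning
      a : ℤ
      a = ℤ.- + n

module _ {c : ℕ} {Y : ConfigSet} where

  Y⊆SFTgap : (∀ j → j < c → ¬ L Y (one0one j)) → ∀ {x} → Y x → SFTgap c x
  Y⊆SFTgap forbidden {x} Yx j j<c occ = forbidden j j<c (x , Yx , occ)

  realized-sparse : (∀ j → j < c → ¬ L Y (one0one j)) → ∀ {n f} → Realized Y n f → Sparse c n f
  realized-sparse forbidden {n} (y , Yy , i , agree) =
    Sparse-resp {f = y from i} agree (SFTgap⇒sparse y (Y⊆SFTgap forbidden Yy) i n)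

  glue : BlockGluing c Y → ∀ {m n f g} → Realized Y m f → Realized Y n g → ∀ l → c ≤ l →
         ∃ λ w → Realized Y (m + (l + n)) (append m f (append l w g))
  glue gluing {m} {n} {f} {g} rf rg l c≤l
    with gluing (applyUpTo f m) (applyUpTo g n) (Realized⇒L rf) (Realized⇒L rg) l c≤l
  ... | w , refl , uwv∈L =
    toWord w , Realized-resp agreement
                 (Realized-≤ (≤-reflexive (sym length-uwv)) (L⇒Realized {w = uwv} uwv∈L))
    where
    uwv : List Bool
    uwv = applyUpTo f m ++ w ++ applyUpTo g n
    length-uwv : length uwv ≡ m + (length w + n)
    length-uwv = trans (length-++ (applyUpTo f m))
      (cong₂ _+_ (length-applyUpTo f m)
                 (trans (length-++ w) (cong (λ j → length w + j) (length-applyUpTo g n))))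
    agreement : Agree (m + (length w + n)) (toWord uwv) (append m f (append (length w) (toWord w) g))
    agreement k k<len = trans (toWord-applyUpTo-++ f m k)
      (append-cong {m = m} (λ _ _ → refl)
        (λ j j<len → trans (toWord-++ w j)
           (append-cong {m = length w} (λ _ _ → refl) (toWord-applyUpTo g n) j j<len))
        k k<len)

module _ {c : ℕ} {Y : ConfigSet} (gluing : BlockGluing c Y)
         (forbidden : ∀ j → j < c → ¬ L Y (one0one j)) where

  -- In 0ⁿ w 0ⁿ with |w| = c + 1, the letters w 0 and w c are at distance c, so one of them is 0.
  zeros-realized : 1 ≤ c → L Y (false ∷ []) → ∀ n → Realized Y n zeros
  zeros-realized _   (y , Yy , i , _) zero    = y , Yy , i , λ _ ()
  zeros-realized 1≤c 0∈L              (suc n) = extend (glue gluing zⁿ zⁿ (suc c) (n≤1+n c))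
    where
    zⁿ : Realized Y n zeros
    zⁿ = zeros-realized 1≤c 0∈L n
    extend : (∃ λ w → Realized Y (n + (suc c + n)) (append n zeros (append (suc c) w zeros))) →
             Realized Y (suc n) zeros
    extend (w , r) with w 0 in w0
    ... | false = Realized-resp (Agree-snoc (append-prefix n) hn) (Realized-≤ (m<m+n n z<s) r)
      where
      hn : append n zeros (append (suc c) w zeros) n ≡ false
      hn = trans (cong (append n zeros (append (suc c) w zeros)) (sym (+-identityʳ n)))
                 (trans (append-+ n 0) w0)
    ... | true = Realized-resp (λ k _ → append-+ c k) (Realized-drop c
                   (Realized-≤ (≤-reflexive (+-suc c n)) (Realized-resp tail (Realized-drop n r))))
      where
      h : Word
      h = append n zeros (append (suc c) w zeros)
      hc : h (n + c) ≡ false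
      hc = Sparse-after (realized-sparse forbidden r) (+-monoʳ-< n 1≤c)
             (≤-reflexive (cong (λ j → j + c) (sym (+-identityʳ n))))
             (+-monoʳ-< n (s≤s (m≤m+n c n))) (trans (append-+ n 0) w0)
      wc : w c ≡ false
      wc = trans (sym (trans (append-+ n c) (append-prefix (suc c) c (n<1+n c)))) hc
      tail : Agree (suc c + n) (drop n h) (append c w zeros)
      tail k _ = trans (append-+ n k) (sym (append-zeros-extend c wc k))

  pulse-realized : L Y (true ∷ []) → ∀ {M} → Realized Y M zeros → Realized Y (suc M) pulse
  pulse-realized 1∈L {M} zᴹ
    with glue gluing (Realized-resp (Agree-cons refl λ _ ()) (L⇒Realized {w = true ∷ []} 1∈L))
                     zᴹ c ≤-refl
  ... | w , r = Realized-≤ (s≤s (m≤n+m M c)) (Realized-resp (Agree-cons refl after-one) r)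
    where
    h : Word
    h = append 1 pulse (append c w zeros)
    w≈0 : Agree c w zeros
    w≈0 t t<c = trans (sym (append-prefix c t t<c))
      (Sparse-after {f = h} (realized-sparse forbidden r) z<s t<c
                    (s≤s (<-≤-trans t<c (m≤m+n c M))) refl)
    after-one : Agree (c + M) (append c w zeros) zeros
    after-one k k<c+M = trans (append-cong w≈0 (λ _ _ → refl) k k<c+M) (append-zeros c k)

  gap-pulse : ∀ {m u M} → Realized Y m u → Realized Y (suc M) pulse →
              Realized Y (m + (c + suc M)) (append m u (append c zeros pulse))
  gap-pulse {m} {u} rᵘ rᵖ with glue gluing rᵘ rᵖ c ≤-refl
  ... | w , r =
    Realized-resp (append-cong {m = m} (λ _ _ → refl) (append-cong {m = c} w≈0 λ _ _ → refl)) r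
    where
    h : Word
    h = append m u (append c w pulse)
    one-at-gap : h (m + c) ≡ true
    one-at-gap = trans (cong (λ j → h (m + j)) (sym (+-identityʳ c)))
                       (trans (append-+ m (c + 0)) (append-+ c 0))
    w≈0 : Agree c w zeros
    w≈0 t t<c = trans (sym (trans (append-+ m t) (append-prefix c t t<c)))
      (Sparse-before (realized-sparse forbidden r) (+-monoʳ-< m t<c)
        (≤-trans (+-monoʳ-≤ m (m≤n+m c t)) (≤-reflexive (sym (+-assoc m t c))))
        (+-monoʳ-< m (m<m+n c z<s)) one-at-gap)

  zeros-pulse-realized : ∀ {N M} → N ≤ c → Realized Y (suc M) pulse →
                         Realized Y (N + suc M) (append N zeros pulse)
  zeros-pulse-realized {N} {M} N≤c rᵖ =
    Realized-resp (λ k _ → drop-append s zeros pulse k)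
      (Realized-drop s (Realized-≤ (≤-reflexive (sym (+-assoc s N (suc M))))
        (subst (λ L → Realized Y (L + suc M) (append L zeros pulse)) (sym (m∸n+n≡m N≤c))
          (gap-pulse (Realized-≤ z≤n rᵖ) rᵖ))))
    where
    s : ℕ
    s = c ∸ N

  pulse-after-prefix : ∀ {f} → (∀ n → Sparse c n f) → ∀ N {M} → f N ≡ true → Realized Y N f →
                       Realized Y (suc M) pulse →
                       ∃ λ g → Agree N f g × Realized Y (N + suc M) (append N g pulse)
  pulse-after-prefix {f} sparse N fN rᶠ rᵖ with c ≤? N
  ... | no c≰N = zeros , zeros-before , zeros-pulse-realized (<⇒≤ N<c) rᵖ
    where
    N<c : N < c
    N<c = ≰⇒> c≰N
    zeros-before : Agree N f zeros
    zeros-before k k<N =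
      Sparse-before (sparse (suc N)) k<N (≤-trans (<⇒≤ N<c) (m≤n+m c k)) (n<1+n N) fN
  pulse-after-prefix {f} sparse N {M} fN rᶠ rᵖ | yes c≤N with N ∸ c | m∸n+n≡m c≤N
  ... | P | refl = append P f zeros , f≈prefix ,
    Realized-resp (λ k _ → sym (append-assoc P f zeros pulse k))
      (Realized-≤ (≤-reflexive (+-assoc P c (suc M))) (gap-pulse (Realized-≤ (m≤m+n P c) rᶠ) rᵖ))
    where
    gap-zeros : Agree c (drop P f) zeros
    gap-zeros t t<c = Sparse-before (sparse (suc (P + c))) (+-monoʳ-< P t<c)
      (≤-trans (+-monoʳ-≤ P (m≤n+m c t)) (≤-reflexive (sym (+-assoc P t c)))) (n<1+n (P + c)) fN
    f≈prefix : Agree (P + c) f (append P f zeros)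
    f≈prefix k k<P+c =
      trans (append-take-drop P f k) (append-cong {m = P} (λ _ _ → refl) gap-zeros k k<P+c)

  sparse-realized : 1 ≤ c → L Y (false ∷ []) → L Y (true ∷ []) →
                    ∀ {f} → (∀ n → Sparse c n f) → ∀ N M → Realized Y (N + M) (append N f zeros)
  sparse-realized 1≤c 0∈L 1∈L sparse zero M = zeros-realized 1≤c 0∈L M
  sparse-realized 1≤c 0∈L 1∈L {f} sparse (suc N) M with f N in fN
  ... | false = Realized-resp (λ k _ → append-zeros-extend N fN k)
                  (Realized-≤ (≤-reflexive (sym (+-suc N M)))
                    (sparse-realized 1≤c 0∈L 1∈L sparse N (suc M)))
  ... | true with pulse-after-prefix sparse N fN prefix (pulse-realized 1∈L (zeros-realized 1≤c 0∈L M))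
    where
    prefix : Realized Y N f
    prefix = Realized-resp (append-prefix N)
               (Realized-≤ (m≤m+n N 0) (sparse-realized 1≤c 0∈L 1∈L sparse N 0))
  ...   | g , f≈g , r = Realized-resp (λ k _ → sym (append-zeros-ending-in-one N fN f≈g k))
                          (Realized-≤ (≤-reflexive (sym (+-suc N M))) r)

mainTheorem15 : (c : ℕ) → c ≥ 1 → (Y : ConfigSet) → Subshift Y →
    BlockGluing c Y → L Y (false ∷ []) → L Y (true ∷ []) →
    (∀ j → j < c → ¬ L Y (one0one j)) →
    ∀ x → Y x ⇔ SFTgap c x
mainTheorem15 c c≥1 Y Y-subshift gluing 0∈L 1∈L forbidden x =
  mk⇔ (Y⊆SFTgap forbidden) λ gap → language-closed Y-subshift λ a n →
    Realized-resp (append-prefix n) (Realized-≤ (m≤m+n n 0)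
      (sparse-realized gluing forbidden c≥1 0∈L 1∈L (SFTgap⇒sparse x gap a) n 0))
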